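{- Let $k\geq 0$ and let $q_0,q_1,\ldots,q_{k+1}$ be Dyck paths (possibly empty). Let $\hat p:=(\nearrow)\circ q_1\circ(\nearrow)\circ q_2\circ(\nearrow)\circ\cdots\circ(\nearrow)\circ q_{k+1}\circ(\nearrow,\nearrow,\searrow,\searrow)\circ(\searrow)^k\circ(\nearrow,\searrow)\circ(\searrow)\circ q_0$ and $\check p:=(\nearrow)\circ q_1\circ(\nearrow)\circ q_2\circ(\nearrow)\circ\cdots\circ(\nearrow)\circ q_{k+1}\circ(\nearrow,\nearrow,\nearrow,\searrow,\searrow,\searrow)\circ(\searrow)^k\circ(\searrow)\circ q_0$, where in both paths the prefix contains exactly $k+1$ upsteps $(\nearrow)$ interleaved with $q_1,\ldots,q_{k+1}$ (one before each $q_i$). Then there is a Dyck path $q'$ such that $h(\hat p)=(\nearrow)\circ q'\circ(\nearrow,\nearrow,\searrow,\searrow)\circ(\searrow)\circ h(q_0)$ and $h(\check p)=(\nearrow)\circ q'\circ(\nearrow,\searrow,\nearrow,\searrow)\circ(\searrow)\circ h(q_0)$.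
   Context: Lattice paths are sequences of steps $\nearrow$ (upstep) and $\searrow$ (downstep); $\circ$ denotes concatenation, $()$ the empty path and $(\searrow)^k$ the path of $k$ downsteps. A Dyck path of length $2m$ is a path with $m$ upsteps and $m$ downsteps that, started at height $0$, never goes below height $0$. For a path $q$ of even length $2m$, $\pi_1(q)$ is obtained by swapping the steps at positions $2i$ and $2i+1$ for every $i=1,\ldots,m-1$ ($\pi_1(())=()$). Define $h$ on Dyck paths recursively: $h(()):=()$; if $p=(\nearrow)\circ p'\circ(\searrow)$ with $p'$ a Dyck path, then $h(p):=(\nearrow)\circ\pi_1(h(p'))\circ(\searrow)$; otherwise write $p=p_1\circ p_2$ with $p_1,p_2$ nonempty Dyck paths and set $h(p):=h(p_1)\circ h(p_2)$ (independent of the chosen decomposition). -}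

module Defs where

open import Data.Nat using (ℕ; zero; suc)
open import Data.List using (List; []; _∷_; _++_; length; replicate)
open import Data.Maybe using (Maybe; just; nothing)
open import Data.Product using (_×_; _,_)
open import Data.Empty using (⊥)
open import Relation.Binary.PropositionalEquality using (_≡_)
open import Data.Vec using (Vec; toList)
open import Data.List using (concatMap)

data Step : Set where
  up down : Step

Path : Set
Path = List Step

-- Valid n p : started at height n, p never goes below 0 and ends at height 0
Valid : ℕ → Path → Set
Valid n [] = n ≡ 0
Valid n (up ∷ xs) = Valid (suc n) xs
Valid zero (down ∷ xs) = ⊥
Valid (suc n) (down ∷ xs) = Valid n xs

IsDyck : Path → Set
IsDyck = Valid 0

-- π₁ : keep step 1, swap steps 2i and 2i+1 (i = 1..m-1); last step stays
swapPairs : Path → Path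
swapPairs (a ∷ b ∷ r) = b ∷ a ∷ swapPairs r
swapPairs r = r

π₁ : Path → Path
π₁ [] = []
π₁ (x ∷ xs) = x ∷ swapPairs xs

-- first-return split: after an initial upstep, find the matching downstep.
-- splitRet n xs : xs read at relative height n above the return level;
-- returns (p' , rest) with xs = p' ++ down ∷ rest for the first return.
splitRet : ℕ → Path → Maybe (Path × Path)
splitRet n [] = nothing
splitRet zero (down ∷ xs) = just ([] , xs)
splitRet (suc n) (down ∷ xs) with splitRet n xs
... | just (a , b) = just (down ∷ a , b)
... | nothing = nothing
splitRet n (up ∷ xs) with splitRet (suc n) xs
... | just (a , b) = just (up ∷ a , b)
... | nothing = nothing

-- h with fuel, using the first-return decomposition
-- p = (↗) ∘ p' ∘ (↘) ∘ rest  ↦  (↗) ∘ π₁(h p') ∘ (↘) ∘ h rest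
-- (for rest = () this is the prime case; otherwise it is h(p₁) ∘ h(p₂)
--  with p₁ the first prime factor, valid since h is decomposition-independent).
-- The value on non-Dyck paths is irrelevant.
hF : ℕ → Path → Path
hF zero _ = []
hF (suc f) [] = []
hF (suc f) (down ∷ xs) = []
hF (suc f) (up ∷ xs) with splitRet zero xs
... | just (p' , rest) = up ∷ (π₁ (hF f p') ++ (down ∷ hF f rest))
... | nothing = []

h : Path → Path
h p = hF (length p) p

upsInterleaved : ∀ {n} → Vec Path n → Path
upsInterleaved qs = concatMap (λ q → up ∷ q) (toList qs)

downs : ℕ → Path
downs k = replicate k down

pHat : (k : ℕ) → Vec Path (suc k) → Path → Path
pHat k qs q₀ = upsInterleaved qs ++ ((up ∷ up ∷ down ∷ down ∷ []) ++ (downs k ++ ((up ∷ down ∷ []) ++ (down ∷ q₀))))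

pCheck : (k : ℕ) → Vec Path (suc k) → Path → Path
pCheck k qs q₀ = upsInterleaved qs ++ ((up ∷ up ∷ up ∷ down ∷ down ∷ down ∷ []) ++ (downs k ++ (down ∷ q₀)))

module Submission where

-- The map h is computed from first-return decompositions, so we first establish
-- the two equations that characterise it on Dyck paths (independently of the fuel
-- used in its definition):  h((↗)∘a∘(↘)∘r) = (↗)∘π₁(h a)∘(↘)∘h r  and
-- h(a∘b) = h a ∘ h b.  Next, h always produces even-length paths, and π₁ acts on
-- w∘t, for w of odd length, as π₁ w ∘ swapPairs t.  Hence a tail t of h A survives
-- the next layer q ↦ (↗)∘(q∘A)∘(↘) only through swapPairs t.
-- Writing p̂ and p̌ as (↗)∘q₁∘(tower)∘…∘(↘)∘q₀, where the tower
-- (↗)∘q₂∘⋯∘(↗)∘q_{k+1}∘T∘(↘)^k is built on T = (↗↗↘↘) resp. (↗↗↗↘↘↘), we show by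
-- induction on the tower that h maps both to a common odd-length "stem" followed by
-- the tails (↗↘↘) resp. (↗↘↗↘↘); these tails are reproduced by every layer.  The
-- outermost layer then turns the two tails into (↘↗↗↘↘) and (↘↗↘↗↘), which gives
-- the theorem with q' = π₁(h q₁ ∘ stem) ∘ (↘).

open import Defs
open import Data.Nat using (ℕ; zero; suc; _+_; _≤_; s≤s)
open import Data.Nat.Properties using (suc-injective; ≤-refl; ≤-trans; n≤1+n)
open import Data.List using ([]; _∷_; _++_; length)
open import Data.List.Properties
  using (++-assoc; ++-identityʳ; ++-monoid; length-++-≤ˡ; length-++-≤ʳ)
open import Data.Maybe using (just; nothing)
open import Data.Vec using (Vec; []; _∷_)
open import Data.Vec.Relation.Unary.All using (All; []; _∷_)
open import Data.Product using (Σ; _×_; _,_)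
open import Relation.Binary.PropositionalEquality
  using (_≡_; refl; sym; trans; cong; cong₂; subst; module ≡-Reasoning)
open import Algebra.Solver.Monoid (++-monoid Step) using (solve; _⊜_; _⊕_)

open ≡-Reasoning

Valid-++ : ∀ {m} n a {b} → Valid n a → Valid m b → Valid (n + m) (a ++ b)
Valid-++ n [] refl vb = vb
Valid-++ n (up ∷ a) va vb = Valid-++ (suc n) a va vb
Valid-++ (suc n) (down ∷ a) va vb = Valid-++ n a va vb

Dyck-++ : ∀ a b → IsDyck a → IsDyck b → IsDyck (a ++ b)
Dyck-++ a b = Valid-++ 0 a

Valid-height : ∀ {m n} p → Valid m p → Valid n p → m ≡ n
Valid-height [] vm vn = trans vm (sym vn)
Valid-height (up ∷ p) vm vn = suc-injective (Valid-height p vm vn)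
Valid-height {suc m} {suc n} (down ∷ p) vm vn = cong suc (Valid-height p vm vn)

Valid-prefix : ∀ n a {b} → Valid n (a ++ b) → IsDyck b → Valid n a
Valid-prefix n [] {b} vb db = Valid-height b vb db
Valid-prefix n (up ∷ a) v db = Valid-prefix (suc n) a v db
Valid-prefix (suc n) (down ∷ a) v db = Valid-prefix n a v db

first-return : ∀ n xs → Valid (suc n) xs →
  Σ Path λ a → Σ Path λ r → (xs ≡ a ++ down ∷ r) × Valid n a × IsDyck r
first-return n (up ∷ xs) v with first-return (suc n) xs v
... | a , r , refl , va , dr = up ∷ a , r , refl , va , dr
first-return zero (down ∷ xs) v = [] , xs , refl , refl , v
first-return (suc n) (down ∷ xs) v with first-return n xs v
... | a , r , refl , va , dr = down ∷ a , r , refl , va , dr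

splitRet-first-return : ∀ n a r → Valid n a → splitRet n (a ++ down ∷ r) ≡ just (a , r)
splitRet-first-return n [] r refl = refl
splitRet-first-return zero (up ∷ a) r va
  rewrite splitRet-first-return 1 a r va = refl
splitRet-first-return (suc n) (up ∷ a) r va
  rewrite splitRet-first-return (suc (suc n)) a r va = refl
splitRet-first-return (suc n) (down ∷ a) r va
  rewrite splitRet-first-return n a r va = refl

part-lengths : ∀ a r {f} → length (a ++ down ∷ r) ≤ f → length a ≤ f × length r ≤ f
part-lengths a r l =
  ≤-trans (length-++-≤ˡ a) l ,
  ≤-trans (n≤1+n _) (≤-trans (length-++-≤ʳ (down ∷ r) {a}) l)

hF-prime : ∀ f {a} r → IsDyck a →
  hF (suc f) (up ∷ a ++ down ∷ r) ≡ up ∷ π₁ (hF f a) ++ down ∷ hF f r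
hF-prime f {a} r da rewrite splitRet-first-return 0 a r da = refl

hF-[] : ∀ f → hF f [] ≡ []
hF-[] zero = refl
hF-[] (suc f) = refl

hF-fuel : ∀ f g p → IsDyck p → length p ≤ f → length p ≤ g → hF f p ≡ hF g p
hF-fuel f g [] _ _ _ = trans (hF-[] f) (sym (hF-[] g))
hF-fuel (suc f) (suc g) (up ∷ xs) dp (s≤s lf) (s≤s lg) with first-return 0 xs dp
... | a , r , refl , da , dr
  with part-lengths a r lf | part-lengths a r lg
... | laf , lrf | lag , lrg = begin
  hF (suc f) (up ∷ a ++ down ∷ r)     ≡⟨ hF-prime f r da ⟩
  up ∷ π₁ (hF f a) ++ down ∷ hF f r   ≡⟨ cong₂ (λ x y → up ∷ π₁ x ++ down ∷ y)
                                          (hF-fuel f g a da laf lag) (hF-fuel f g r dr lrf lrg) ⟩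
  up ∷ π₁ (hF g a) ++ down ∷ hF g r   ≡⟨ sym (hF-prime g r da) ⟩
  hF (suc g) (up ∷ a ++ down ∷ r)     ∎

h-prime : ∀ a r → IsDyck a → IsDyck r →
  h (up ∷ a ++ down ∷ r) ≡ up ∷ π₁ (h a) ++ down ∷ h r
h-prime a r da dr with part-lengths a r ≤-refl
... | la , lr =
  trans (hF-prime _ r da)
        (cong₂ (λ x y → up ∷ π₁ x ++ down ∷ y)
               (hF-fuel _ _ a da la ≤-refl) (hF-fuel _ _ r dr lr ≤-refl))

h-++-bounded : ∀ f a {b} → length a ≤ f → IsDyck a → IsDyck b → h (a ++ b) ≡ h a ++ h b
h-++-bounded f [] _ _ _ = refl
h-++-bounded (suc f) (up ∷ xs) {b} (s≤s l) dxs db with first-return 0 xs dxs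
... | a , r , refl , da , dr with part-lengths a r l
... | _ , lr = begin
  h (up ∷ (a ++ down ∷ r) ++ b)          ≡⟨ cong (λ x → h (up ∷ x)) (++-assoc a (down ∷ r) b) ⟩
  h (up ∷ a ++ down ∷ (r ++ b))          ≡⟨ h-prime a (r ++ b) da (Dyck-++ r b dr db) ⟩
  up ∷ π₁ (h a) ++ down ∷ h (r ++ b)     ≡⟨ cong (λ x → up ∷ π₁ (h a) ++ down ∷ x)
                                               (h-++-bounded f r lr dr db) ⟩
  up ∷ π₁ (h a) ++ down ∷ (h r ++ h b)   ≡⟨ cong (up ∷_) (sym (++-assoc (π₁ (h a)) (down ∷ h r) (h b))) ⟩
  (up ∷ π₁ (h a) ++ down ∷ h r) ++ h b   ≡⟨ cong (_++ h b) (sym (h-prime a r da dr)) ⟩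
  h (up ∷ a ++ down ∷ r) ++ h b          ∎

h-++ : ∀ a b → IsDyck a → IsDyck b → h (a ++ b) ≡ h a ++ h b
h-++ a b = h-++-bounded (length a) a ≤-refl

-- 2j, by recursion, so that the odd height 2j+1 can be matched on.
twice : ℕ → ℕ
twice zero = zero
twice (suc j) = suc (suc (twice j))

-- Swapping consecutive pairs keeps a path valid when it starts at an odd height:
-- pair boundaries stay at odd heights ≥ 1, so a swapped (↘,↗) never goes below 0.
swapPairs-valid : ∀ j xs → Valid (suc (twice j)) xs → Valid (suc (twice j)) (swapPairs xs)
swapPairs-valid j [] v = v
swapPairs-valid j (x ∷ []) v = v
swapPairs-valid j (up ∷ up ∷ r) v = swapPairs-valid (suc j) r v
swapPairs-valid j (up ∷ down ∷ r) v = swapPairs-valid j r v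
swapPairs-valid j (down ∷ up ∷ r) v = swapPairs-valid j r v
swapPairs-valid (suc j) (down ∷ down ∷ r) v = swapPairs-valid j r v

-- π₁ keeps the first step and swaps pairs after it, starting from height 1.
π₁-Dyck : ∀ p → IsDyck p → IsDyck (π₁ p)
π₁-Dyck [] dp = dp
π₁-Dyck (up ∷ xs) dp = swapPairs-valid 0 xs dp

hF-Dyck : ∀ f p → IsDyck p → IsDyck (hF f p)
hF-Dyck zero p _ = refl
hF-Dyck (suc f) [] _ = refl
hF-Dyck (suc f) (up ∷ xs) dp with first-return 0 xs dp
... | a , r , refl , da , dr =
  subst IsDyck (sym (hF-prime f r da))
        (Valid-++ 0 (π₁ (hF f a)) (π₁-Dyck (hF f a) (hF-Dyck f a da)) (hF-Dyck f r dr))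

h-Dyck : ∀ p → IsDyck p → IsDyck (h p)
h-Dyck p = hF-Dyck (length p) p

data Even : Path → Set
data Odd : Path → Set

data Even where
  even[] : Even []
  even∷ : ∀ {x xs} → Odd xs → Even (x ∷ xs)

data Odd where
  odd∷ : ∀ {x xs} → Even xs → Odd (x ∷ xs)

Odd-++ : ∀ {a b} → Even a → Odd b → Odd (a ++ b)
Odd-++ even[] ob = ob
Odd-++ (even∷ (odd∷ ea)) ob = odd∷ (even∷ (Odd-++ ea ob))

Odd-snoc : ∀ {a} y → Odd a → Even (a ++ y ∷ [])
Odd-snoc y (odd∷ e) = even∷ (Odd-++ e (odd∷ even[]))

swapPairs-Even : ∀ {xs} → Even xs → Even (swapPairs xs)
swapPairs-Even even[] = even[]
swapPairs-Even (even∷ (odd∷ e)) = even∷ (odd∷ (swapPairs-Even e))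

swapPairs-Odd : ∀ {xs} → Odd xs → Odd (swapPairs xs)
swapPairs-Odd (odd∷ even[]) = odd∷ even[]
swapPairs-Odd (odd∷ (even∷ o)) = odd∷ (even∷ (swapPairs-Odd o))

π₁-Even : ∀ {p} → Even p → Even (π₁ p)
π₁-Even even[] = even[]
π₁-Even (even∷ o) = even∷ (swapPairs-Odd o)

π₁-Odd : ∀ {p} → Odd p → Odd (π₁ p)
π₁-Odd (odd∷ e) = odd∷ (swapPairs-Even e)

hF-Even : ∀ f p → Even (hF f p)
hF-Even zero p = even[]
hF-Even (suc f) [] = even[]
hF-Even (suc f) (down ∷ xs) = even[]
hF-Even (suc f) (up ∷ xs) with splitRet zero xs
... | just (a , r) = even∷ (Odd-++ (π₁-Even (hF-Even f a)) (odd∷ (hF-Even f r)))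
... | nothing = even[]

h-Even : ∀ p → Even (h p)
h-Even p = hF-Even (length p) p

swapPairs-++ : ∀ {a} t → Even a → swapPairs (a ++ t) ≡ swapPairs a ++ swapPairs t
swapPairs-++ t even[] = refl
swapPairs-++ {x ∷ y ∷ _} t (even∷ (odd∷ e)) = cong (λ z → y ∷ x ∷ z) (swapPairs-++ t e)

π₁-++ : ∀ {w} t → Odd w → π₁ (w ++ t) ≡ π₁ w ++ swapPairs t
π₁-++ {x ∷ _} t (odd∷ e) = cong (x ∷_) (swapPairs-++ t e)

π₁-h-layer : ∀ q A {w} t → IsDyck q → IsDyck A → Odd w → h A ≡ w ++ t →
  π₁ (h (q ++ A)) ≡ π₁ (h q ++ w) ++ swapPairs t
π₁-h-layer q A {w} t dq dA ow hA = begin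
  π₁ (h (q ++ A))       ≡⟨ cong π₁ (h-++ q A dq dA) ⟩
  π₁ (h q ++ h A)       ≡⟨ cong (λ x → π₁ (h q ++ x)) hA ⟩
  π₁ (h q ++ (w ++ t))  ≡⟨ cong π₁ (sym (++-assoc (h q) w t)) ⟩
  π₁ ((h q ++ w) ++ t)  ≡⟨ π₁-++ t (Odd-++ (h-Even q) ow) ⟩
  π₁ (h q ++ w) ++ swapPairs t ∎

h-outer : ∀ X q₀ q' T → IsDyck X → IsDyck q₀ → π₁ (h X) ≡ q' ++ T →
  h (up ∷ X ++ down ∷ q₀) ≡ up ∷ (q' ++ (T ++ down ∷ h q₀))
h-outer X q₀ q' T dX dq₀ eX = begin
  h (up ∷ X ++ down ∷ q₀)          ≡⟨ h-prime X q₀ dX dq₀ ⟩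
  up ∷ π₁ (h X) ++ down ∷ h q₀     ≡⟨ cong (λ x → up ∷ x ++ down ∷ h q₀) eX ⟩
  up ∷ (q' ++ T) ++ down ∷ h q₀    ≡⟨ cong (up ∷_) (++-assoc q' T (down ∷ h q₀)) ⟩
  up ∷ (q' ++ (T ++ down ∷ h q₀))  ∎

tower : ∀ {n} → Vec Path n → Path → Path
tower {n} qs T = upsInterleaved qs ++ (T ++ downs n)

-- The common part of h(tower qs T) for all tops T considered below, built layer by
-- layer: each layer q contributes (↗)∘cap q qs, where cap q qs = π₁(h q ∘ stem qs)∘(↘).
stem : ∀ {n} → Vec Path n → Path
stem [] = up ∷ []
stem (q ∷ qs) = up ∷ (π₁ (h q ++ stem qs) ++ down ∷ [])

cap : ∀ {n} → Path → Vec Path n → Path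
cap q qs = π₁ (h q ++ stem qs) ++ down ∷ []

stem-Odd : ∀ {n} (qs : Vec Path n) → Odd (stem qs)
stem-Odd [] = odd∷ even[]
stem-Odd (q ∷ qs) = odd∷ (Odd-snoc down (π₁-Odd (Odd-++ (h-Even q) (stem-Odd qs))))

downs-snoc : ∀ n → downs n ++ down ∷ [] ≡ down ∷ downs n
downs-snoc zero = refl
downs-snoc (suc n) = cong (down ∷_) (downs-snoc n)

tower-∷ : ∀ {n} q (qs : Vec Path n) T →
  tower (q ∷ qs) T ≡ up ∷ (q ++ tower qs T) ++ down ∷ []
tower-∷ {n} q qs T = cong (up ∷_) (begin
  (q ++ U) ++ (T ++ down ∷ downs n)           ≡⟨ cong (λ d → (q ++ U) ++ (T ++ d)) (sym (downs-snoc n)) ⟩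
  (q ++ U) ++ (T ++ (downs n ++ down ∷ []))   ≡⟨ reassociate q U T (downs n) (down ∷ []) ⟩
  (q ++ (U ++ (T ++ downs n))) ++ down ∷ []   ∎)
  where
  U = upsInterleaved qs
  reassociate : ∀ (a b c d e : Path) → (a ++ b) ++ (c ++ (d ++ e)) ≡ (a ++ (b ++ (c ++ d))) ++ e
  reassociate = solve 5 (λ a b c d e → (a ⊕ b) ⊕ (c ⊕ (d ⊕ e)) ⊜ (a ⊕ (b ⊕ (c ⊕ d))) ⊕ e) refl

tower-Dyck : ∀ {n} T {qs : Vec Path n} → IsDyck T → All IsDyck qs → IsDyck (tower qs T)
tower-Dyck T dT [] = subst IsDyck (sym (++-identityʳ T)) dT
tower-Dyck T {q ∷ qs} dT (dq ∷ dqs) =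
  subst IsDyck (sym (tower-∷ q qs T))
        (Valid-++ 0 (q ++ tower qs T) (Dyck-++ q (tower qs T) dq (tower-Dyck T dT dqs)) refl)

π₁-h-cap : ∀ {n} q A (qs : Vec Path n) t T → IsDyck q → IsDyck A → h A ≡ stem qs ++ t →
  swapPairs t ≡ down ∷ T → π₁ (h (q ++ A)) ≡ cap q qs ++ T
π₁-h-cap q A qs t T dq dA hA swap-t = begin
  π₁ (h (q ++ A))                          ≡⟨ π₁-h-layer q A t dq dA (stem-Odd qs) hA ⟩
  π₁ (h q ++ stem qs) ++ swapPairs t       ≡⟨ cong (π₁ (h q ++ stem qs) ++_) swap-t ⟩
  π₁ (h q ++ stem qs) ++ down ∷ T          ≡⟨ sym (++-assoc (π₁ (h q ++ stem qs)) (down ∷ []) T) ⟩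
  cap q qs ++ T                            ∎

h-tower : ∀ {n} T t (qs : Vec Path n) → IsDyck T → h T ≡ up ∷ t →
  swapPairs t ++ down ∷ [] ≡ down ∷ t → All IsDyck qs → h (tower qs T) ≡ stem qs ++ t
h-tower T t [] dT hT stable [] = trans (cong h (++-identityʳ T)) hT
h-tower T t (q ∷ qs) dT hT stable (dq ∷ dqs) = begin
  h (tower (q ∷ qs) T)                           ≡⟨ cong h (tower-∷ q qs T) ⟩
  h (up ∷ (q ++ A) ++ down ∷ [])                 ≡⟨ h-prime (q ++ A) [] (Dyck-++ q A dq dA) refl ⟩
  up ∷ π₁ (h (q ++ A)) ++ down ∷ []              ≡⟨ cong (λ x → up ∷ x ++ down ∷ [])
                                                      (π₁-h-layer q A t dq dA (stem-Odd qs) hA) ⟩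
  up ∷ (P ++ swapPairs t) ++ down ∷ []           ≡⟨ cong (up ∷_) (++-assoc P (swapPairs t) (down ∷ [])) ⟩
  up ∷ P ++ (swapPairs t ++ down ∷ [])           ≡⟨ cong (λ x → up ∷ P ++ x) stable ⟩
  up ∷ P ++ (down ∷ t)                           ≡⟨ cong (up ∷_) (sym (++-assoc P (down ∷ []) t)) ⟩
  stem (q ∷ qs) ++ t                             ∎
  where
  P = π₁ (h q ++ stem qs)
  A = tower qs T
  dA = tower-Dyck T dT dqs
  hA = h-tower T t qs dT hT stable dqs

T̂ Ť t̂ ť : Path
T̂ = up ∷ up ∷ down ∷ down ∷ []
Ť = up ∷ up ∷ up ∷ down ∷ down ∷ down ∷ []
t̂ = up ∷ down ∷ down ∷ []
ť = up ∷ down ∷ up ∷ down ∷ down ∷ []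

-- The parts of p̂ and p̌ strictly between q₁ and the final (↘)∘q₀.
Â Ǎ : ∀ {n} → Vec Path n → Path
Â qs = tower qs T̂ ++ up ∷ down ∷ []
Ǎ qs = tower qs Ť

Â-Dyck : ∀ {n} {qs : Vec Path n} → All IsDyck qs → IsDyck (Â qs)
Â-Dyck {qs = qs} dqs = Dyck-++ (tower qs T̂) _ (tower-Dyck T̂ refl dqs) refl

Ǎ-Dyck : ∀ {n} {qs : Vec Path n} → All IsDyck qs → IsDyck (Ǎ qs)
Ǎ-Dyck = tower-Dyck Ť refl

h-Â : ∀ {n} {qs : Vec Path n} → All IsDyck qs → h (Â qs) ≡ stem qs ++ (t̂ ++ up ∷ down ∷ [])
h-Â {qs = qs} dqs = begin
  h (tower qs T̂ ++ up ∷ down ∷ [])       ≡⟨ h-++ (tower qs T̂) _ (tower-Dyck T̂ refl dqs) refl ⟩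
  h (tower qs T̂) ++ up ∷ down ∷ []       ≡⟨ cong (_++ up ∷ down ∷ []) (h-tower T̂ t̂ qs refl refl refl dqs) ⟩
  (stem qs ++ t̂) ++ up ∷ down ∷ []       ≡⟨ ++-assoc (stem qs) t̂ (up ∷ down ∷ []) ⟩
  stem qs ++ (t̂ ++ up ∷ down ∷ [])       ∎

h-Ǎ : ∀ {n} {qs : Vec Path n} → All IsDyck qs → h (Ǎ qs) ≡ stem qs ++ ť
h-Ǎ {qs = qs} = h-tower Ť ť qs refl refl refl

pHat-shape : ∀ k q₁ (qs : Vec Path k) q₀ →
  pHat k (q₁ ∷ qs) q₀ ≡ up ∷ (q₁ ++ Â qs) ++ down ∷ q₀
pHat-shape k q₁ qs q₀ =
  cong (up ∷_) (reassociate q₁ (upsInterleaved qs) T̂ (downs k) (up ∷ down ∷ []) (down ∷ q₀))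
  where
  reassociate : ∀ (a b c d e f : Path) →
    (a ++ b) ++ (c ++ (d ++ (e ++ f))) ≡ (a ++ ((b ++ (c ++ d)) ++ e)) ++ f
  reassociate = solve 6 (λ a b c d e f →
    (a ⊕ b) ⊕ (c ⊕ (d ⊕ (e ⊕ f))) ⊜ (a ⊕ ((b ⊕ (c ⊕ d)) ⊕ e)) ⊕ f) refl

pCheck-shape : ∀ k q₁ (qs : Vec Path k) q₀ →
  pCheck k (q₁ ∷ qs) q₀ ≡ up ∷ (q₁ ++ Ǎ qs) ++ down ∷ q₀
pCheck-shape k q₁ qs q₀ =
  cong (up ∷_) (reassociate q₁ (upsInterleaved qs) Ť (downs k) (down ∷ q₀))
  where
  reassociate : ∀ (a b c d e : Path) → (a ++ b) ++ (c ++ (d ++ e)) ≡ (a ++ (b ++ (c ++ d))) ++ e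
  reassociate = solve 5 (λ a b c d e → (a ⊕ b) ⊕ (c ⊕ (d ⊕ e)) ⊜ (a ⊕ (b ⊕ (c ⊕ d))) ⊕ e) refl

-- The theorem, with q' = cap q₁ qs: the outer layer turns the tails into
-- swapPairs (t̂ ∘ (↗↘)) = (↘)∘(↗↗↘↘) and swapPairs ť = (↘)∘(↗↘↗↘).
lemma20 : (k : ℕ) (q₀ : Path) (qs : Vec Path (suc k)) →
    IsDyck q₀ → All IsDyck qs →
    Σ Path (λ q' → IsDyck q' ×
      (h (pHat k qs q₀) ≡ up ∷ (q' ++ ((up ∷ up ∷ down ∷ down ∷ []) ++ (down ∷ h q₀)))) ×
      (h (pCheck k qs q₀) ≡ up ∷ (q' ++ ((up ∷ down ∷ up ∷ down ∷ []) ++ (down ∷ h q₀)))))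
lemma20 k q₀ (q₁ ∷ qs) dq₀ (dq₁ ∷ dqs) =
  cap q₁ qs , cap-Dyck ,
  trans (cong h (pHat-shape k q₁ qs q₀)) (h-outer (q₁ ++ Â qs) q₀ (cap q₁ qs) _ dX̂ dq₀ π₁X̂) ,
  trans (cong h (pCheck-shape k q₁ qs q₀)) (h-outer (q₁ ++ Ǎ qs) q₀ (cap q₁ qs) _ dX̌ dq₀ π₁X̌)
  where
  dX̂ = Dyck-++ q₁ (Â qs) dq₁ (Â-Dyck dqs)
  dX̌ = Dyck-++ q₁ (Ǎ qs) dq₁ (Ǎ-Dyck dqs)
  π₁X̂ : π₁ (h (q₁ ++ Â qs)) ≡ cap q₁ qs ++ T̂
  π₁X̂ = π₁-h-cap q₁ (Â qs) qs _ T̂ dq₁ (Â-Dyck dqs) (h-Â dqs) refl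
  π₁X̌ : π₁ (h (q₁ ++ Ǎ qs)) ≡ cap q₁ qs ++ (up ∷ down ∷ up ∷ down ∷ [])
  π₁X̌ = π₁-h-cap q₁ (Ǎ qs) qs ť _ dq₁ (Ǎ-Dyck dqs) (h-Ǎ dqs) refl
  -- cap q₁ qs ∘ T̂ = π₁(h(q₁ ∘ Â qs)) is a Dyck path, and so is its prefix
  cap-Dyck : IsDyck (cap q₁ qs)
  cap-Dyck = Valid-prefix 0 (cap q₁ qs) (subst IsDyck π₁X̂ (π₁-Dyck (h (q₁ ++ Â qs)) (h-Dyck (q₁ ++ Â qs) dX̂))) refl
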